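{- Let $\ell\geq 3$ and let $n_1,\dots,n_\ell$ be integers with $n_i\ge 2$ for all $i$. Let $G$ be the xor-product of the complete graphs $K_{n_1},\dots,K_{n_\ell}$. Then the clique number satisfies $$\omega(G)\geq n_1+n_2+\cdots+n_\ell-2\ell-1.$$
   Context: The xor-product $G_1 \cdots G_\ell$ of graphs has vertex set $V(G_1)\times\cdots\times V(G_\ell)$, and two distinct vertices $(g_1,\dots,g_\ell)$, $(g_1',\dots,g_\ell')$ are adjacent iff $g_ig_i'\in E(G_i)$ for an odd number of indices $i$ (in a complete graph, $g_ig_i'$ is an edge iff $g_i\neq g_i'$). -}

module Defs where

open import Data.Nat using (ℕ; zero; suc; _+_)
open import Data.Nat.Properties using (_≟_)
open import Data.Fin using (Fin)
import Data.Fin.Properties as FinP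
open import Data.List using (List; length)
open import Data.List.Relation.Unary.AllPairs using (AllPairs)
open import Data.Vec.Functional using (Vector; foldr)
open import Data.Product using (_×_)
open import Relation.Nullary using (¬_; Dec; yes; no)
open import Relation.Binary.PropositionalEquality using (_≡_)

sumᶠ : ∀ {ℓ} → (Fin ℓ → ℕ) → ℕ
sumᶠ f = foldr _+_ 0 f

Vertex : ∀ {ℓ} → (Fin ℓ → ℕ) → Set
Vertex {ℓ} n = (i : Fin ℓ) → Fin (n i)

edgeInd : ∀ {m} → Fin m → Fin m → ℕ
edgeInd a b with a FinP.≟ b
... | yes _ = 0
... | no _  = 1

edgeCount : ∀ {ℓ} {n : Fin ℓ → ℕ} → Vertex n → Vertex n → ℕ
edgeCount g g' = sumᶠ (λ i → edgeInd (g i) (g' i))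

data Odd : ℕ → Set where
  odd1 : Odd 1
  odd+2 : ∀ {k} → Odd k → Odd (suc (suc k))

Adj : ∀ {ℓ} {n : Fin ℓ → ℕ} → Vertex n → Vertex n → Set
Adj g g' = ¬ (g ≡ g') × Odd (edgeCount g g')

IsClique : ∀ {ℓ} {n : Fin ℓ → ℕ} → List (Vertex n) → Set
IsClique = AllPairs Adj

-- Write D u v (parityDist) for the parity of the Hamming distance, so that u and v are adjacent iff D u v
-- is odd, and fix a centre z.  Call S a switched clique if D z u + D z v + D u v is odd for all distinct u, v
-- in S: a clique of G Seidel-switched at the neighbourhood of z.  Prefixing every u in S by the digit D z u
-- turns S into a genuine clique of K_N G, and the column (a, y), 2 ≤ a < N, may be added as soon as some y
-- has even distance to every member; this gains N − 2 vertices.  Switched cliques grow by a factor in the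
-- same way: prefix S by 1, add the column (a, z), 2 ≤ a < N, and recentre at (0, z).  A vertex y with parity
-- X to S and w to z then yields (digit (X + w), y) with parities (w + 1, X), so the property "for each c
-- there is such a y with X = c and one with w = c" survives every step.  Two factors establish it at the
-- cost of one vertex, and after ℓ − 1 factors a y with X = 0 finishes the clique.
module Submission where

open import Defs
open import Algebra.Properties.CommutativeSemigroup using (interchange)
open import Data.Fin using (Fin; zero; suc; toℕ; cast; _↑ʳ_)
open import Data.Fin.Properties using (_≟_; toℕ-cast; toℕ-↑ʳ; toℕ-injective; toℕ<n)
open import Data.List using (List; []; length; map; _++_; tabulate)
open import Data.List.Properties using (length-++; length-map; length-tabulate)
open import Data.List.Relation.Unary.All as All using (All; [])
import Data.List.Relation.Unary.All.Properties as All
open import Data.List.Relation.Unary.AllPairs as AllPairs using (AllPairs; [])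
import Data.List.Relation.Unary.AllPairs.Properties as AllPairs
open import Data.Nat using (ℕ; zero; suc; _≥_; _*_; _+_; _∸_; _≤_; _<_; z≤n; s≤s; _≤?_; parity)
open import Data.Nat.Properties as ℕ
  using (≤-refl; ≤-trans; <-≤-trans; <-irrefl; m≤m+n; m≤n+m∸n; m+[n∸m]≡n; m≤n+o⇒m∸n≤o; n≤1+n;
         +-mono-≤; +-monoˡ-≤; +-cancelˡ-≡)
open import Data.Nat.Tactic.RingSolver using (solve-∀)
open import Data.Parity.Base using (Parity; 0ℙ; 1ℙ; _⁻¹) renaming (_+_ to _⊕_)
open import Data.Parity.Properties as ℙ using (+-homo-+; p+p≡0ℙ; p≢p⁻¹; ⁻¹-involutive)
open import Data.Product using (Σ; _×_; _,_; proj₁; proj₂; Σ-syntax)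
open import Data.Vec.Functional using (Vector; head; tail)
open import Function using (_∘_)
open import Relation.Binary.PropositionalEquality
  using (_≡_; _≢_; refl; sym; trans; cong; cong₂; subst; module ≡-Reasoning)
open import Relation.Nullary using (yes; no; ¬_; contradiction)

private
  variable
    k d lo : ℕ
    m : ℕ

differ : Fin m → Fin m → Parity
differ a b = parity (edgeInd a b)

differ-refl : (a : Fin m) → differ a a ≡ 0ℙ
differ-refl a with a ≟ a
... | yes _   = refl
... | no a≢a = contradiction refl a≢a

differ-≢ : {a b : Fin m} → a ≢ b → differ a b ≡ 1ℙ
differ-≢ {a = a} {b} a≢b with a ≟ b
... | yes a≡b = contradiction a≡b a≢b
... | no _    = refl

differ-< : {a b : Fin m} → toℕ a < toℕ b → differ a b ≡ 1ℙ
differ-< a<b = differ-≢ λ a≡b → <-irrefl (cong toℕ a≡b) a<b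

differ-> : {a b : Fin m} → toℕ b < toℕ a → differ a b ≡ 1ℙ
differ-> b<a = differ-≢ λ a≡b → <-irrefl (cong toℕ (sym a≡b)) b<a

digit : ∀ {N} → 2 ≤ N → Parity → Fin N
digit (s≤s (s≤s _)) 0ℙ = zero
digit (s≤s (s≤s _)) 1ℙ = suc zero

differ-digit : ∀ {N} (2≤N : 2 ≤ N) p q → differ (digit 2≤N p) (digit 2≤N q) ≡ p ⊕ q
differ-digit (s≤s (s≤s _)) 0ℙ 0ℙ = refl
differ-digit (s≤s (s≤s _)) 0ℙ 1ℙ = refl
differ-digit (s≤s (s≤s _)) 1ℙ 0ℙ = refl
differ-digit (s≤s (s≤s _)) 1ℙ 1ℙ = refl

toℕ-digit<2 : ∀ {N} (2≤N : 2 ≤ N) p → toℕ (digit 2≤N p) < 2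
toℕ-digit<2 (s≤s (s≤s _)) 0ℙ = s≤s z≤n
toℕ-digit<2 (s≤s (s≤s _)) 1ℙ = s≤s (s≤s z≤n)

two : ∀ {N} → 3 ≤ N → Fin N
two (s≤s (s≤s (s≤s _))) = suc (suc zero)

toℕ-two : ∀ {N} (3≤N : 3 ≤ N) → toℕ (two 3≤N) ≡ 2
toℕ-two (s≤s (s≤s (s≤s _))) = refl

differ-two-digit : ∀ {N} (3≤N : 3 ≤ N) (2≤N : 2 ≤ N) p → differ (two 3≤N) (digit 2≤N p) ≡ 1ℙ
differ-two-digit (s≤s (s≤s (s≤s _))) (s≤s (s≤s _)) 0ℙ = refl
differ-two-digit (s≤s (s≤s (s≤s _))) (s≤s (s≤s _)) 1ℙ = refl

module _ {N} (lo≤N : lo ≤ N) where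

  private
    shift : Fin (N ∸ lo) → Fin N
    shift j = cast (m+[n∸m]≡n lo≤N) (lo ↑ʳ j)

    toℕ-shift : ∀ j → toℕ (shift j) ≡ lo + toℕ j
    toℕ-shift j = trans (toℕ-cast _ (lo ↑ʳ j)) (toℕ-↑ʳ lo j)

    lo≤shift : ∀ j → lo ≤ toℕ (shift j)
    lo≤shift j = subst (lo ≤_) (sym (toℕ-shift j)) (m≤m+n lo (toℕ j))

    shift-injective : ∀ {i j} → shift i ≡ shift j → i ≡ j
    shift-injective {i} {j} eq =
      toℕ-injective (+-cancelˡ-≡ lo _ _ (trans (sym (toℕ-shift i)) (trans (cong toℕ eq) (toℕ-shift j))))

  above : List (Fin N)
  above = tabulate shift

  length-above : length above ≡ N ∸ lo
  length-above = length-tabulate shift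

  All-above : ∀ {p} {P : Fin N → Set p} → (∀ {a} → lo ≤ toℕ a → P a) → All P above
  All-above P⁺ = All.tabulate⁺ (P⁺ ∘ lo≤shift)

  AllPairs-above : ∀ {r} {R : Fin N → Fin N → Set r} →
                   (∀ {a b} → lo ≤ toℕ a → lo ≤ toℕ b → a ≢ b → R a b) → AllPairs R above
  AllPairs-above R⁺ = AllPairs.tabulate⁺ λ {i} {j} i≢j →
    R⁺ (lo≤shift i) (lo≤shift j) (i≢j ∘ shift-injective)

parityDist : {n : Vector ℕ k} → Vertex n → Vertex n → Parity
parityDist u v = parity (edgeCount u v)

parityDist-refl : {n : Vector ℕ k} (u : Vertex n) → parityDist u u ≡ 0ℙ
parityDist-refl {zero}  u = refl
parityDist-refl {suc k} u = trans (+-homo-+ (edgeInd (u zero) (u zero)) (edgeCount (u ∘ suc) (u ∘ suc)))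
  (cong₂ _⊕_ (differ-refl (u zero)) (parityDist-refl (u ∘ suc)))

parity≡1ℙ⇒Odd : ∀ m → parity m ≡ 1ℙ → Odd m
parity≡1ℙ⇒Odd 0             ()
parity≡1ℙ⇒Odd 1             _  = odd1
parity≡1ℙ⇒Odd (suc (suc m)) eq = odd+2 (parity≡1ℙ⇒Odd m eq)

adjacent : {n : Vector ℕ k} {u v : Vertex n} → parityDist u v ≡ 1ℙ → Adj u v
adjacent {u = u} eq = (λ { refl → p≢p⁻¹ 0ℙ (trans (sym (parityDist-refl u)) eq) }) , parity≡1ℙ⇒Odd _ eq

switched : {n : Vector ℕ k} (z u v : Vertex n) → Parity
switched z u v = parityDist z u ⊕ parityDist z v ⊕ parityDist u v

IsSwitchedClique : {n : Vector ℕ k} → Vertex n → List (Vertex n) → Set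
IsSwitchedClique z = AllPairs λ u v → switched z u v ≡ 1ℙ

switched-repeated : {n : Vector ℕ k} (z u : Vertex n) → switched z z u ≡ 0ℙ
switched-repeated z u = trans (cong (λ p → p ⊕ parityDist z u ⊕ parityDist z u) (parityDist-refl z))
                              (p+p≡0ℙ (parityDist z u))

record SwitchedClique (n : Vector ℕ k) : Set where
  field
    centre           : Vertex n
    members          : List (Vertex n)
    isSwitchedClique : IsSwitchedClique centre members

open SwitchedClique using (centre; members)

record Witness {n : Vector ℕ k} (K : SwitchedClique n) (X w : Parity) : Set where
  field
    vertex    : Vertex n
    toMembers : All (λ u → parityDist vertex u ≡ X) (members K)
    toCentre  : parityDist vertex (centre K) ≡ w

Large : (n : Vector ℕ k) → ℕ → SwitchedClique n → Set
Large n d K = sumᶠ n ≤ d + length (members K)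

Large-weaken : ∀ {d d′} {n : Vector ℕ k} (K : SwitchedClique n) → d ≤ d′ → Large n d K → Large n d′ K
Large-weaken K d≤d′ large = ≤-trans large (+-monoˡ-≤ (length (members K)) d≤d′)

Covers : {n : Vector ℕ k} → SwitchedClique n → Set
Covers K = ∀ c → Σ Parity (Witness K c) × Σ Parity (λ X → Witness K X c)

module _ {k} {n : Vector ℕ (suc k)} where

  infixr 5 _◂_

  _◂_ : Fin (head n) → Vertex (tail n) → Vertex n
  (a ◂ u) zero    = a
  (a ◂ u) (suc i) = u i

  parityDist-◂ : ∀ a b (u v : Vertex (tail n)) → parityDist (a ◂ u) (b ◂ v) ≡ differ a b ⊕ parityDist u v
  parityDist-◂ a b u v = +-homo-+ (edgeInd a b) (edgeCount u v)

  switched-◂ : (a b c : Fin (head n)) {z u v : Vertex (tail n)} {p q r s : Parity} →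
               differ a b ≡ p → differ a c ≡ q → differ b c ≡ r → switched z u v ≡ s →
               switched (a ◂ z) (b ◂ u) (c ◂ v) ≡ p ⊕ q ⊕ r ⊕ s
  switched-◂ a b c {z} {u} {v} refl refl refl refl = begin
    parityDist (a ◂ z) (b ◂ u) ⊕ parityDist (a ◂ z) (c ◂ v) ⊕ parityDist (b ◂ u) (c ◂ v)
      ≡⟨ cong₂ _⊕_ (cong₂ _⊕_ (parityDist-◂ a b z u) (parityDist-◂ a c z v)) (parityDist-◂ b c u v) ⟩
    (differ a b ⊕ parityDist z u) ⊕ (differ a c ⊕ parityDist z v) ⊕ (differ b c ⊕ parityDist u v)
      ≡⟨ cong (_⊕ _) (interchange ℙ.+-commutativeSemigroup (differ a b) _ (differ a c) _) ⟩
    (differ a b ⊕ differ a c) ⊕ (parityDist z u ⊕ parityDist z v) ⊕ (differ b c ⊕ parityDist u v)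
      ≡⟨ interchange ℙ.+-commutativeSemigroup (differ a b ⊕ differ a c) _ (differ b c) _ ⟩
    differ a b ⊕ differ a c ⊕ differ b c ⊕ switched z u v ∎
    where open ≡-Reasoning

  module _ {lo} (lo≤N : lo ≤ head n) where

    graft : (Vertex (tail n) → Fin (head n)) → Vertex (tail n) → List (Vertex (tail n)) → List (Vertex n)
    graft colour y S = map (_◂ y) (above lo≤N) ++ map (λ u → colour u ◂ u) S

    length-graft : ∀ colour y S → length (graft colour y S) ≡ (head n ∸ lo) + length S
    length-graft colour y S = begin
      length (graft colour y S)
        ≡⟨ length-++ (map (_◂ y) (above lo≤N)) ⟩
      length (map (_◂ y) (above lo≤N)) + length (map (λ u → colour u ◂ u) S)
        ≡⟨ cong₂ _+_ (trans (length-map (_◂ y) (above lo≤N)) (length-above lo≤N)) (length-map _ S) ⟩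
      (head n ∸ lo) + length S ∎
      where open ≡-Reasoning

    sumᶠ-graft : ∀ {d colour y S} → sumᶠ (tail n) ≤ d + length S →
                 sumᶠ n ≤ (lo + d) + length (graft colour y S)
    sumᶠ-graft {d} {colour} {y} {S} large = begin
      head n + sumᶠ (tail n)                   ≤⟨ +-mono-≤ (m≤n+m∸n (head n) lo) large ⟩
      (lo + (head n ∸ lo)) + (d + length S)    ≡⟨ interchange ℕ.+-commutativeSemigroup lo _ d _ ⟩
      (lo + d) + ((head n ∸ lo) + length S)    ≡⟨ cong ((lo + d) +_) (sym (length-graft colour y S)) ⟩
      (lo + d) + length (graft colour y S)     ∎
      where open ℕ.≤-Reasoning

    All-graft : ∀ {P : Vertex n → Set} {colour y S} →
                (∀ {a} → lo ≤ toℕ a → P (a ◂ y)) → All (λ u → P (colour u ◂ u)) S → All P (graft colour y S)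
    All-graft column lifted = All.++⁺ (All.map⁺ (All-above lo≤N column)) (All.map⁺ lifted)

    AllPairs-graft : ∀ {R : Vertex n → Vertex n → Set} {colour y S} →
                     (∀ {a b} → lo ≤ toℕ a → lo ≤ toℕ b → a ≢ b → R (a ◂ y) (b ◂ y)) →
                     (∀ {a} → lo ≤ toℕ a → All (λ u → R (a ◂ y) (colour u ◂ u)) S) →
                     AllPairs (λ u v → R (colour u ◂ u) (colour v ◂ v)) S →
                     AllPairs R (graft colour y S)
    AllPairs-graft column across lifted =
      AllPairs.++⁺ (AllPairs.map⁺ (AllPairs-above lo≤N column)) (AllPairs.map⁺ lifted)
                   (All.map⁺ (All-above lo≤N (All.map⁺ ∘ across)))

  module _ (2≤N : 2 ≤ head n) where

    private
      ⌜_⌝ : Parity → Fin (head n)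
      ⌜_⌝ = digit 2≤N

      digit<big : ∀ {a : Fin (head n)} p → 2 ≤ lo → lo ≤ toℕ a → toℕ ⌜ p ⌝ < toℕ a
      digit<big p 2≤lo lo≤a = <-≤-trans (toℕ-digit<2 2≤N p) (≤-trans 2≤lo lo≤a)

    extend : 2 ≤ lo → lo ≤ head n → SwitchedClique (tail n) → SwitchedClique n
    extend {lo} 2≤lo lo≤N K = record
      { centre           = ⌜ 0ℙ ⌝ ◂ z
      ; members          = graft lo≤N (λ _ → ⌜ 1ℙ ⌝) z S
      ; isSwitchedClique = AllPairs-graft lo≤N column across lifted
      }
      where
      open SwitchedClique K renaming (centre to z; members to S)
      column : ∀ {a b} → lo ≤ toℕ a → lo ≤ toℕ b → a ≢ b → switched (⌜ 0ℙ ⌝ ◂ z) (a ◂ z) (b ◂ z) ≡ 1ℙ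
      column {a} {b} lo≤a lo≤b a≢b =
        switched-◂ ⌜ 0ℙ ⌝ a b (differ-< (digit<big 0ℙ 2≤lo lo≤a)) (differ-< (digit<big 0ℙ 2≤lo lo≤b))
                              (differ-≢ a≢b) (switched-repeated z z)
      across : ∀ {a} → lo ≤ toℕ a → All (λ u → switched (⌜ 0ℙ ⌝ ◂ z) (a ◂ z) (⌜ 1ℙ ⌝ ◂ u) ≡ 1ℙ) S
      across {a} lo≤a = All.universal (λ u →
        switched-◂ ⌜ 0ℙ ⌝ a ⌜ 1ℙ ⌝ (differ-< (digit<big 0ℙ 2≤lo lo≤a)) (differ-digit 2≤N 0ℙ 1ℙ)
                                   (differ-> (digit<big 1ℙ 2≤lo lo≤a)) (switched-repeated z u)) S
      lifted : AllPairs (λ u v → switched (⌜ 0ℙ ⌝ ◂ z) (⌜ 1ℙ ⌝ ◂ u) (⌜ 1ℙ ⌝ ◂ v) ≡ 1ℙ) S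
      lifted = AllPairs.map (switched-◂ ⌜ 0ℙ ⌝ ⌜ 1ℙ ⌝ ⌜ 1ℙ ⌝ (differ-digit 2≤N 0ℙ 1ℙ) (differ-digit 2≤N 0ℙ 1ℙ)
                                                     (differ-digit 2≤N 1ℙ 1ℙ))
                            isSwitchedClique

    extend-large : (2≤lo : 2 ≤ lo) (lo≤N : lo ≤ head n) (K : SwitchedClique (tail n)) →
                   Large (tail n) d K → Large n (lo + d) (extend 2≤lo lo≤N K)
    extend-large _ lo≤N _ = sumᶠ-graft lo≤N

    extend-witness : ∀ {X w X′ w′} (2≤lo : 2 ≤ lo) (lo≤N : lo ≤ head n) (K : SwitchedClique (tail n))
                     (e : Fin (head n)) → (∀ {a} → lo ≤ toℕ a → differ e a ⊕ w ≡ X′) →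
                     differ e ⌜ 1ℙ ⌝ ⊕ X ≡ X′ → differ e ⌜ 0ℙ ⌝ ⊕ w ≡ w′ →
                     Witness K X w → Witness (extend 2≤lo lo≤N K) X′ w′
    extend-witness 2≤lo lo≤N K e column lifted centred W = record
      { vertex    = e ◂ vertex
      ; toMembers = All-graft lo≤N (λ {a} lo≤a → via a toCentre (column lo≤a))
                                   (All.map (λ y≡X → via ⌜ 1ℙ ⌝ y≡X lifted) toMembers)
      ; toCentre  = via ⌜ 0ℙ ⌝ toCentre centred
      }
      where
      open Witness W
      via : ∀ {u p q} b → parityDist vertex u ≡ p → differ e b ⊕ p ≡ q → parityDist (e ◂ vertex) (b ◂ u) ≡ q
      via {u} b refl eq = trans (parityDist-◂ e b vertex u) eq

    extend-witness-rotate : ∀ {X w} (2≤lo : 2 ≤ lo) (lo≤N : lo ≤ head n) (K : SwitchedClique (tail n)) →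
                            Witness K X w → Witness (extend 2≤lo lo≤N K) (w ⁻¹) X
    extend-witness-rotate {X = X} {w} 2≤lo lo≤N K = extend-witness 2≤lo lo≤N K ⌜ X ⊕ w ⌝
      (λ lo≤a → cong (_⊕ w) (differ-< (digit<big (X ⊕ w) 2≤lo lo≤a)))
      (trans (cong (_⊕ X) (differ-digit 2≤N (X ⊕ w) 1ℙ)) (proj₁ (rotation X w)))
      (trans (cong (_⊕ w) (differ-digit 2≤N (X ⊕ w) 0ℙ)) (proj₂ (rotation X w)))
      where
      rotation : ∀ X w → (X ⊕ w ⊕ 1ℙ ⊕ X ≡ w ⁻¹) × (X ⊕ w ⊕ 0ℙ ⊕ w ≡ X)
      rotation 0ℙ 0ℙ = refl , refl
      rotation 0ℙ 1ℙ = refl , refl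
      rotation 1ℙ 0ℙ = refl , refl
      rotation 1ℙ 1ℙ = refl , refl

    extend-witness-two : ∀ {X} (3≤N : 3 ≤ head n) (K : SwitchedClique (tail n)) →
                         Witness K X X → Witness (extend (n≤1+n 2) 3≤N K) (X ⁻¹) (X ⁻¹)
    extend-witness-two {X} 3≤N K = extend-witness (n≤1+n 2) 3≤N K (two 3≤N)
      (λ {a} 3≤a → cong (_⊕ X) (differ-< (subst (_< toℕ a) (sym (toℕ-two 3≤N)) 3≤a)))
      (cong (_⊕ X) (differ-two-digit 3≤N 2≤N 1ℙ))
      (cong (_⊕ X) (differ-two-digit 3≤N 2≤N 0ℙ))

    extend-witness-narrow : ∀ {X w} → ¬ 3 ≤ head n → (K : SwitchedClique (tail n)) →
                            Witness K X w → Witness (extend ≤-refl 2≤N K) (X ⁻¹) w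
    extend-witness-narrow {X} {w} 3≰N K = extend-witness ≤-refl 2≤N K ⌜ 0ℙ ⌝
      (λ {a} 2≤a → contradiction (≤-trans (s≤s 2≤a) (toℕ<n a)) 3≰N)
      (cong (_⊕ X) (differ-digit 2≤N 0ℙ 1ℙ))
      (cong (_⊕ w) (differ-digit 2≤N 0ℙ 0ℙ))

    extend-covers : (K : SwitchedClique (tail n)) → Covers K → Covers (extend ≤-refl 2≤N K)
    extend-covers K covers c = toMembers-c (proj₂ (covers (c ⁻¹))) , toCentre-c (proj₁ (covers c))
      where
      K′ : SwitchedClique n
      K′ = extend ≤-refl 2≤N K
      toMembers-c : Σ Parity (λ X → Witness K X (c ⁻¹)) → Σ Parity (Witness K′ c)
      toMembers-c (X , W) =
        X , subst (λ c′ → Witness K′ c′ X) (⁻¹-involutive c) (extend-witness-rotate ≤-refl 2≤N K W)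
      toCentre-c : Σ Parity (Witness K c) → Σ Parity (λ X → Witness K′ X c)
      toCentre-c (w , W) = w ⁻¹ , extend-witness-rotate ≤-refl 2≤N K W

    unswitch : ∀ {w} (K : SwitchedClique (tail n)) → Large (tail n) d K → Witness K 0ℙ w →
               Σ[ C ∈ List (Vertex n) ] IsClique C × sumᶠ n ≤ (2 + d) + length C
    unswitch K large W =
      graft 2≤N colour vertex S , AllPairs-graft 2≤N column across lifted , sumᶠ-graft 2≤N large
      where
      open SwitchedClique K renaming (centre to z; members to S)
      open Witness W
      colour : Vertex (tail n) → Fin (head n)
      colour u = ⌜ parityDist z u ⌝
      column : ∀ {a b} → 2 ≤ toℕ a → 2 ≤ toℕ b → a ≢ b → Adj (a ◂ vertex) (b ◂ vertex)
      column {a} {b} _ _ a≢b =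
        adjacent (trans (parityDist-◂ a b vertex vertex) (cong₂ _⊕_ (differ-≢ a≢b) (parityDist-refl vertex)))
      across : ∀ {a} → 2 ≤ toℕ a → All (λ u → Adj (a ◂ vertex) (colour u ◂ u)) S
      across {a} 2≤a = All.map (λ {u} y≡0 → adjacent (trans (parityDist-◂ a (colour u) vertex u)
                                                             (cong₂ _⊕_ (differ-> (digit<big _ ≤-refl 2≤a)) y≡0)))
                               toMembers
      lifted : AllPairs (λ u v → Adj (colour u ◂ u) (colour v ◂ v)) S
      lifted = AllPairs.map (λ {u} {v} s≡1 → adjacent (trans (parityDist-◂ (colour u) (colour v) u v)
                                 (trans (cong (_⊕ parityDist u v) (differ-digit 2≤N _ _)) s≡1)))
                            isSwitchedClique

covers-from : {n : Vector ℕ k} {K : SwitchedClique n} →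
              Witness K 0ℙ 0ℙ → Witness K 0ℙ 1ℙ → Witness K 1ℙ 1ℙ → Covers K
covers-from W₀₀ W₀₁ W₁₁ 0ℙ = (1ℙ , W₀₁) , (0ℙ , W₀₀)
covers-from W₀₀ W₀₁ W₁₁ 1ℙ = (1ℙ , W₁₁) , (1ℙ , W₁₁)

-- The theorem's slack of one vertex is spent here: when N ≥ 3 the value 2 stays out of the column, free to be
-- the first coordinate of a witness of parities (0ℙ, 0ℙ); when N = 2 the column is empty anyway.
extend-to-covering : ∀ {k d} {n : Vector ℕ (suc k)} (2≤N : 2 ≤ head n) (K : SwitchedClique (tail n)) →
                     Large (tail n) d K → Witness K 1ℙ 0ℙ → Witness K 1ℙ 1ℙ →
                     Σ[ K′ ∈ SwitchedClique n ] Large n (3 + d) K′ × Covers K′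
extend-to-covering {d = d} {n = n} 2≤N K large W₁₀ W₁₁ with 3 ≤? head n
... | yes 3≤N = extend 2≤N (n≤1+n 2) 3≤N K ,
                extend-large {n = n} 2≤N (n≤1+n 2) 3≤N K large ,
                covers-from (extend-witness-two 2≤N 3≤N K W₁₁)
                            (extend-witness-rotate 2≤N (n≤1+n 2) 3≤N K W₁₁)
                            (extend-witness-rotate 2≤N (n≤1+n 2) 3≤N K W₁₀)
... | no 3≰N  = K′ ,
                Large-weaken K′ (n≤1+n (2 + d)) (extend-large {n = n} 2≤N ≤-refl 2≤N K large) ,
                covers-from (extend-witness-narrow 2≤N 3≰N K W₁₀)
                            (extend-witness-rotate 2≤N ≤-refl 2≤N K W₁₁)
                            (extend-witness-rotate 2≤N ≤-refl 2≤N K W₁₀)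
  where
  K′ : SwitchedClique n
  K′ = extend 2≤N ≤-refl 2≤N K

empty : (n : Vector ℕ 0) → SwitchedClique n
empty n = record { centre = λ (); members = []; isSwitchedClique = [] }

empty-witness : {n : Vector ℕ 0} (X : Parity) → Witness (empty n) X 0ℙ
empty-witness X = record { vertex = λ (); toMembers = []; toCentre = refl }

covering₂ : (n : Vector ℕ 2) → (∀ i → 2 ≤ n i) → Σ[ K ∈ SwitchedClique n ] Large n 5 K × Covers K
covering₂ n n≥2 =
  extend-to-covering (n≥2 zero) K₁ (extend-large {n = tail n} 2≤N′ ≤-refl 2≤N′ K₀ z≤n)
                     (extend-witness-rotate 2≤N′ ≤-refl 2≤N′ K₀ (empty-witness 0ℙ))
                     (extend-witness-rotate 2≤N′ ≤-refl 2≤N′ K₀ (empty-witness 1ℙ))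
  where
  2≤N′ : 2 ≤ head (tail n)
  2≤N′ = n≥2 (suc zero)
  K₀ : SwitchedClique (tail (tail n))
  K₀ = empty (tail (tail n))
  K₁ : SwitchedClique (tail n)
  K₁ = extend 2≤N′ ≤-refl 2≤N′ K₀

covering : ∀ j (n : Vector ℕ (2 + j)) → (∀ i → 2 ≤ n i) →
           Σ[ K ∈ SwitchedClique n ] Large n (5 + j * 2) K × Covers K
covering zero    n n≥2 = covering₂ n n≥2
covering (suc j) n n≥2 =
  let K , large , covers = covering j (tail n) (n≥2 ∘ suc)
  in extend (n≥2 zero) ≤-refl (n≥2 zero) K , extend-large {n = n} (n≥2 zero) ≤-refl (n≥2 zero) K large ,
     extend-covers (n≥2 zero) K covers

deficit : ∀ j → 2 + (5 + j * 2) ≡ 2 * (3 + j) + 1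
deficit = solve-∀

theorem3p3 : (ℓ : ℕ) → ℓ ≥ 3 → (n : Fin ℓ → ℕ) → ((i : Fin ℓ) → n i ≥ 2) →
    Σ (List (Vertex n)) (λ C → IsClique C × length C ≥ sumᶠ n ∸ (2 * ℓ + 1))
theorem3p3 (suc (suc (suc j))) (s≤s (s≤s (s≤s _))) n n≥2 =
  let K , large , covers     = covering j (tail n) (n≥2 ∘ suc)
      C , isClique , bound = unswitch (n≥2 zero) K large (proj₂ (proj₁ (covers 0ℙ)))
  in C , isClique , m≤n+o⇒m∸n≤o (sumᶠ n) _ (subst (λ d → sumᶠ n ≤ d + length C) (deficit j) bound)
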